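{- Let $\Sigma_3=\{0,1,2\}$. Every infinite squarefree word $w$ over $\Sigma_3$ contains at least one occurrence of each of the words $012$, $021$, $102$, $120$, $201$, $210$ (as subwords, i.e. factors of consecutive letters).
   Context: An infinite word over an alphabet $\Sigma$ is a right-infinite sequence $w=w_1w_2w_3\cdots$ of letters of $\Sigma$. A word $u$ is a subword (factor) of $w$ if $u$ occurs as a block of consecutive letters of $w$. A square is a word of the form $xx$ with $x$ a nonempty word; a (finite or infinite) word is squarefree if none of its subwords is a square. -}

module Defs where

open import Data.Nat using (ℕ; zero; suc; _+_; _<_)
open import Data.Fin using (Fin; zero; suc; toℕ)
open import Data.List using (List; []; _∷_; length; lookup)
open import Data.Product using (∃; _×_)
open import Relation.Binary.PropositionalEquality using (_≡_)
open import Relation.Nullary using (¬_)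

Σ₃ : Set
Σ₃ = Fin 3

InfWord : Set
InfWord = ℕ → Σ₃

OccursAt : InfWord → List Σ₃ → ℕ → Set
OccursAt w u i = (k : Fin (length u)) → w (i + toℕ k) ≡ lookup u k

IsFactor : List Σ₃ → InfWord → Set
IsFactor u w = ∃ λ i → OccursAt w u i

SquareAt : InfWord → ℕ → ℕ → Set
SquareAt w i n = (0 < n) × ((k : ℕ) → k < n → w (i + k) ≡ w (i + n + k))

Squarefree : InfWord → Set
Squarefree w = (i n : ℕ) → ¬ SquareAt w i n

c0 c1 c2 : Σ₃
c0 = zero
c1 = suc zero
c2 = suc (suc zero)

module Submission where

-- A square, or an occurrence of u, in a word first becomes visible as a suffix of the prefix
-- ending with its last letter. So if a squarefree ternary word w avoided u, every prefix of w
-- would be reached in the tree of finite words grown letter by letter and pruned as soon as a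
-- square or u appears as a suffix. For u = 012 an exhaustive search shows that this tree has
-- no node of length 30, hence w contains 012. A permutation of the letters preserves
-- squarefreeness and carries 012 to each of the other five patterns.

open import Defs
open import Data.Bool using (true)
open import Data.Bool.Properties using (T-≡)
open import Data.Empty using (⊥-elim)
open import Data.Fin using (zero; suc; toℕ; fromℕ<; _≟_)
open import Data.Fin.Permutation
  using (Permutation′; _⟨$⟩ʳ_; _⟨$⟩ˡ_; inverseʳ; id; transpose; _∘ₚ_)
open import Data.Fin.Properties using (all?; toℕ-fromℕ<)
open import Data.List
  using (List; []; _∷_; _++_; length; map; lookup; reverse; inits; applyUpTo; applyDownFrom)
open import Data.List.Properties
  using (∷-injectiveˡ; ∷-injectiveʳ; length-++; length-reverse; length-applyUpTo; lookup-applyUpTo;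
         reverse-++; reverse-involutive; reverse-applyUpTo)
open import Data.List.Relation.Binary.Pointwise using (Pointwise-≡⇒≡)
open import Data.List.Relation.Binary.Prefix.Heterogeneous using (Prefix)
open import Data.List.Relation.Binary.Prefix.Heterogeneous.Properties using (prefix?)
open import Data.List.Relation.Binary.Suffix.Heterogeneous using (Suffix; here; there)
open import Data.List.Relation.Binary.Suffix.Heterogeneous.Properties using (fromPrefix-rev)
open import Data.List.Relation.Unary.Any using (Any; any?; satisfied)
open import Data.Nat using (ℕ; zero; suc; _+_; _<_; _<?_)
open import Data.Nat.Properties using (suc-injective; +-assoc)
open import Data.Product using (∃; _×_; _,_)
open import Data.Sum using (_⊎_; inj₁; inj₂)
open import Function.Bundles using (Equivalence; Inverse)
open import Relation.Binary.PropositionalEquality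
  using (_≡_; refl; sym; trans; cong; subst; module ≡-Reasoning)
open import Relation.Nullary using (Dec; isYes; ¬_)
open import Relation.Nullary.Decidable using (toWitness; _×-dec_; _⊎-dec_)

module _ {a} {A : Set a} where

  factorAt : (ℕ → A) → ℕ → ℕ → List A
  factorAt f i m = applyUpTo (λ k → f (i + k)) m

  ++-injective : ∀ (xs ys : List A) {xs′ ys′ : List A} → length xs ≡ length ys →
                 xs ++ xs′ ≡ ys ++ ys′ → xs ≡ ys × xs′ ≡ ys′
  ++-injective []       []       _   eq = refl , eq
  ++-injective (x ∷ xs) (y ∷ ys) len eq
    with refl ← ∷-injectiveˡ eq
    with refl , eq′ ← ++-injective xs ys (suc-injective len) (∷-injectiveʳ eq) = refl , eq′

  applyUpTo-+ : ∀ (f : ℕ → A) m n →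
                applyUpTo f (m + n) ≡ applyUpTo f m ++ applyUpTo (λ k → f (m + k)) n
  applyUpTo-+ f zero    n = refl
  applyUpTo-+ f (suc m) n = cong (f 0 ∷_) (applyUpTo-+ (λ k → f (suc k)) m n)

  applyUpTo⇒lookup : ∀ {f : ℕ → A} {n u} → applyUpTo f n ≡ u →
                     ∀ k → f (toℕ k) ≡ lookup u k
  applyUpTo⇒lookup {f} {n} refl k = sym (lookup-applyUpTo f n k)

  applyUpTo-halves : ∀ (f : ℕ → A) y → applyUpTo f (length (y ++ y)) ≡ y ++ y →
                     applyUpTo f (length y) ≡ y ×
                     applyUpTo (λ k → f (length y + k)) (length y) ≡ y
  applyUpTo-halves f y eq =
    ++-injective (applyUpTo f m) y (length-applyUpTo f m)
      (trans (sym (applyUpTo-+ f m m)) (subst (λ l → applyUpTo f l ≡ y ++ y) (length-++ y) eq))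
    where m = length y

  factorAt-square : ∀ (f : ℕ → A) i y → factorAt f i (length (y ++ y)) ≡ y ++ y →
                    ∀ k → k < length y → f (i + k) ≡ f (i + length y + k)
  factorAt-square f i y eq k k<m
    with first , second ← applyUpTo-halves (λ k → f (i + k)) y eq = begin
      f (i + k)            ≡⟨ cong (λ j → f (i + j)) (sym (toℕ-fromℕ< k<m)) ⟩
      f (i + toℕ k′)       ≡⟨ applyUpTo⇒lookup first k′ ⟩
      lookup y k′          ≡⟨ sym (applyUpTo⇒lookup second k′) ⟩
      f (i + (m + toℕ k′)) ≡⟨ cong (λ j → f (i + (m + j))) (toℕ-fromℕ< k<m) ⟩
      f (i + (m + k))      ≡⟨ cong f (sym (+-assoc i m k)) ⟩
      f (i + m + k)        ∎
    where
    open ≡-Reasoning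
    m = length y
    k′ = fromℕ< k<m

  suffix-applyUpTo⇒factorAt : ∀ (f : ℕ → A) n {u} → Suffix _≡_ u (applyUpTo f n) →
                              ∃ λ i → factorAt f i (length u) ≡ u
  suffix-applyUpTo⇒factorAt f (suc n) (there s)
    with i , eq ← suffix-applyUpTo⇒factorAt (λ k → f (suc k)) n s = suc i , eq
  suffix-applyUpTo⇒factorAt f n (here eq) with refl ← Pointwise-≡⇒≡ eq =
    0 , cong (applyUpTo f) (length-applyUpTo f n)

  prefix-applyDownFrom⇒factorAt : ∀ (f : ℕ → A) n u →
                                  Prefix _≡_ (reverse u) (applyDownFrom f n) →
                                  ∃ λ i → factorAt f i (length u) ≡ u
  prefix-applyDownFrom⇒factorAt f n u p = suffix-applyUpTo⇒factorAt f n
    (fromPrefix-rev (subst (Prefix _≡_ _) (sym (reverse-applyUpTo f n)) p))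

  reverse-square : ∀ (x : List A) → reverse (reverse x ++ reverse x) ≡ x ++ x
  reverse-square x = trans (reverse-++ (reverse x) (reverse x))
                           (subst (λ y → y ++ y ≡ x ++ x) (sym (reverse-involutive x)) refl)

-- Finite words are stored last letter first, so that growing a word is _∷_ and the prefix of
-- length n of w is applyDownFrom w n; Prefix on lists therefore means suffix of the word.

HasSquarePrefix : List Σ₃ → Set
HasSquarePrefix v = Any (λ x → 0 < length x × Prefix _≡_ (x ++ x) v) (inits v)

Settled : List Σ₃ → List Σ₃ → Set
Settled u v = Prefix _≡_ (reverse u) v ⊎ HasSquarePrefix v

Unavoidable : List Σ₃ → ℕ → List Σ₃ → Set
Unavoidable u zero    v = Settled u v
Unavoidable u (suc d) v = Settled u v ⊎ (∀ x → Unavoidable u d (x ∷ v))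

hasSquarePrefix? : ∀ v → Dec (HasSquarePrefix v)
hasSquarePrefix? v = any? (λ x → (0 <? length x) ×-dec prefix? _≟_ (x ++ x) v) (inits v)

settled? : ∀ u v → Dec (Settled u v)
settled? u v = prefix? _≟_ (reverse u) v ⊎-dec hasSquarePrefix? v

unavoidable? : ∀ u d v → Dec (Unavoidable u d v)
unavoidable? u zero    v = settled? u v
unavoidable? u (suc d) v = settled? u v ⊎-dec all? (λ x → unavoidable? u d (x ∷ v))

module _ (w : InfWord) (squarefree : Squarefree w) where

  ¬HasSquarePrefix-applyDownFrom : ∀ n → ¬ HasSquarePrefix (applyDownFrom w n)
  ¬HasSquarePrefix-applyDownFrom n sq
    with x , 0<∣x∣ , p ← satisfied sq
    with i , eq ← prefix-applyDownFrom⇒factorAt w n (reverse x ++ reverse x)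
                    (subst (λ z → Prefix _≡_ z _) (sym (reverse-square x)) p) =
    squarefree i (length (reverse x))
      (subst (0 <_) (sym (length-reverse x)) 0<∣x∣ , factorAt-square w i (reverse x) eq)

  settled-sound : ∀ u n → Settled u (applyDownFrom w n) → IsFactor u w
  settled-sound u n (inj₁ p) with i , eq ← prefix-applyDownFrom⇒factorAt w n u p =
    i , applyUpTo⇒lookup eq
  settled-sound u n (inj₂ sq) = ⊥-elim (¬HasSquarePrefix-applyDownFrom n sq)

  unavoidable-sound : ∀ u d n → Unavoidable u d (applyDownFrom w n) → IsFactor u w
  unavoidable-sound u zero    n s          = settled-sound u n s
  unavoidable-sound u (suc d) n (inj₁ s)   = settled-sound u n s
  unavoidable-sound u (suc d) n (inj₂ ext) = unavoidable-sound u d (suc n) (ext (w n))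

squarefree⇒factor : ∀ u d → isYes (unavoidable? u d []) ≡ true →
                    ∀ w → Squarefree w → IsFactor u w
squarefree⇒factor u d found w squarefree = unavoidable-sound w squarefree u d 0
  (toWitness {a? = unavoidable? u d []} (Equivalence.from T-≡ found))

-- The longest squarefree ternary word without the factor 012 has length 29.
squarefree⇒012 : ∀ w → Squarefree w → IsFactor (c0 ∷ c1 ∷ c2 ∷ []) w
squarefree⇒012 = squarefree⇒factor (c0 ∷ c1 ∷ c2 ∷ []) 30 refl

module _ (σ : Permutation′ 3) where

  relabel : InfWord → InfWord
  relabel w i = σ ⟨$⟩ˡ w i

  ⟨$⟩ˡ-inverse : ∀ {x y} → σ ⟨$⟩ˡ x ≡ y → x ≡ σ ⟨$⟩ʳ y
  ⟨$⟩ˡ-inverse eq = sym (Inverse.inverseˡ σ (sym eq))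

  squarefree-relabel : ∀ w → Squarefree w → Squarefree (relabel w)
  squarefree-relabel w squarefree i n (0<n , period) =
    squarefree i n (0<n , λ k k<n → trans (⟨$⟩ˡ-inverse (period k k<n)) (inverseʳ σ))

  factor-relabel : ∀ w {a b c} → IsFactor (a ∷ b ∷ c ∷ []) (relabel w) →
                   IsFactor (map (σ ⟨$⟩ʳ_) (a ∷ b ∷ c ∷ [])) w
  factor-relabel w (i , occ) = i , λ where
    zero             → ⟨$⟩ˡ-inverse (occ zero)
    (suc zero)       → ⟨$⟩ˡ-inverse (occ (suc zero))
    (suc (suc zero)) → ⟨$⟩ˡ-inverse (occ (suc (suc zero)))

theorem1 : (w : InfWord) → Squarefree w →
    IsFactor (c0 ∷ c1 ∷ c2 ∷ []) w × IsFactor (c0 ∷ c2 ∷ c1 ∷ []) w ×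
    IsFactor (c1 ∷ c0 ∷ c2 ∷ []) w × IsFactor (c1 ∷ c2 ∷ c0 ∷ []) w ×
    IsFactor (c2 ∷ c0 ∷ c1 ∷ []) w × IsFactor (c2 ∷ c1 ∷ c0 ∷ []) w
theorem1 w squarefree =
  relabelled id , relabelled (transpose c1 c2) ,
  relabelled (transpose c0 c1) , relabelled (transpose c1 c2 ∘ₚ transpose c0 c1) ,
  relabelled (transpose c0 c1 ∘ₚ transpose c1 c2) , relabelled (transpose c0 c2)
  where
  relabelled : (σ : Permutation′ 3) → IsFactor (map (σ ⟨$⟩ʳ_) (c0 ∷ c1 ∷ c2 ∷ [])) w
  relabelled σ =
    factor-relabel σ w (squarefree⇒012 (relabel σ w) (squarefree-relabel σ w squarefree))
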